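{- Let $D$ be a finite set and $P\subseteq D^r$. There exist partial functions $\psi_1,\psi_3,\psi_5,\dots$ that are partial polymorphisms of $P$ and satisfy the (partial) Catalan identities if and only if $I_D(\mathrm{Cat}_m)$ consists of partial polymorphisms of $P$ for every odd $m$.
   Context: A partial function $f$ of arity $n$ from $D^n$ to $D$ is a partial polymorphism of $P$ if for all $t^{(1)},\dots,t^{(n)}\in P$ such that every column $(t^{(1)}_i,\dots,t^{(n)}_i)$ lies in the domain of $f$, the tuple $(f(t^{(1)}_1,\dots,t^{(n)}_1),\dots,f(t^{(1)}_r,\dots,t^{(n)}_r))\in P$. Partial Catalan identities: $\psi_m$ has arity $m$, $\psi_1$ is total with $\psi_1(x)=x$, and for odd $m\ge3$, $i\in[m-1]$ and $x_1,\dots,x_m$ with $x_i=x_{i+1}$, either both $\psi_m(x_1,\dots,x_m)$ and $\psi_{m-2}(x_1,\dots,x_{i-1},x_{i+2},\dots,x_m)$ are undefined, or both are defined and equal. An $m$-ary polymorphism pattern over a variable set $V$ is a set of pairs $((v_1,\dots,v_m),v)$ with $v_i,v\in V$; $I_D(P)$ is the set of partial functions $f$ from $D^m$ to $D$ such that for every $((v_1,\dots,v_m),v)$ in the pattern and every $g:\{v_1,\dots,v_m,v\}\to D$, $(g(v_1),\dots,g(v_m))$ is in the domain of $f$ and, when $v\in\{v_1,\dots,v_m\}$, $f(g(v_1),\dots,g(v_m))=g(v)$; $f$ is undefined elsewhere. Let $V$ be countably infinite and $\mathrm{Cox}(V)$ the group generated by $V$ subject to $v^2=1$ for all $v\in V$.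 $\mathrm{Cat}_m$ is the $m$-ary pattern over $V$ consisting of all $((v_1,\dots,v_m),v)$ with $v_1v_2^{ -1}v_3\cdots v_{m-1}^{ -1}v_m=v$ in $\mathrm{Cox}(V)$. -}

module Defs where

open import Data.Nat using (ℕ; zero; suc)
open import Data.Fin using (Fin; zero; suc; inject₁)
open import Data.Vec using (Vec; []; _∷_; lookup; map; toList; head)
open import Data.Vec.Membership.Propositional using (_∈_)
open import Data.List using (List; []; _∷_; _++_; [_])
open import Data.Maybe using (Maybe; just; nothing)
open import Data.Product using (Σ; ∃; _×_; _,_)
open import Relation.Binary.PropositionalEquality using (_≡_; _≢_)
open import Relation.Binary.Construct.Closure.Equivalence using (EqClosure)

-- Finite domain D = Fin d.  Tuples in D^n are vectors Vec (Fin d) n.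
-- A partial function D^n → D is a Maybe-valued function
-- (nothing = undefined).

PartialFun : ℕ → ℕ → Set
PartialFun d n = Vec (Fin d) n → Maybe (Fin d)

column : ∀ {A : Set} {n r} → Vec (Vec A r) n → Fin r → Vec A n
column ts j = map (λ t → lookup t j) ts

AllIn : ∀ {A : Set} {n r} → (Vec A r → Set) → Vec (Vec A r) n → Set
AllIn P [] = Data.Unit.⊤ where import Data.Unit
AllIn P (t ∷ ts) = P t × AllIn P ts

IsPartialPolymorphism : ∀ {d r n} → (Vec (Fin d) r → Set) → PartialFun d n → Set
IsPartialPolymorphism {d} {r} {n} P f =
  (ts : Vec (Vec (Fin d) r) n) → AllIn P ts →
  (y : Vec (Fin d) r) → ((j : Fin r) → f (column ts j) ≡ just (lookup y j)) →
  P y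

odd : ℕ → ℕ
odd zero = 1
odd (suc k) = suc (suc (odd k))

removePair : ∀ {A : Set} {n} → Vec A (suc (suc n)) → Fin (suc n) → Vec A n
removePair (a ∷ b ∷ xs) zero = xs
removePair {n = suc n} (a ∷ xs) (suc i) = a ∷ removePair xs i

-- Partial Catalan identities for a family ψ k of arity odd k = 2k+1.
-- Maybe-equality expresses "both undefined, or both defined and equal".
CatalanIdentities : ∀ {d} → ((k : ℕ) → PartialFun d (odd k)) → Set
CatalanIdentities {d} ψ =
  ((x : Vec (Fin d) 1) → ψ zero x ≡ just (head x)) ×
  ((k : ℕ) (x : Vec (Fin d) (odd (suc k))) (i : Fin (suc (odd k))) →
     lookup x (inject₁ i) ≡ lookup x (suc i) →
     ψ (suc k) x ≡ ψ k (removePair x i))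

-- Polymorphism patterns over the countably infinite variable set V = ℕ.

Pattern : ℕ → Set₁
Pattern m = Vec ℕ m → ℕ → Set

-- Assignments g are total maps V → D (equivalent to
-- maps on the finite set {v_1,…,v_m,v} since such maps extend).
InI : ∀ {d m} → Pattern m → PartialFun d m → Set
InI {d} {m} pat f =
  ((vs : Vec ℕ m) (v : ℕ) → pat vs v → (g : ℕ → Fin d) →
     (∃ λ a → f (map g vs) ≡ just a) ×
     (v ∈ vs → f (map g vs) ≡ just (g v))) ×
  ((x : Vec (Fin d) m) → f x ≢ nothing →
     Σ (Vec ℕ m) λ vs → Σ ℕ λ v → pat vs v × (∃ λ (g : ℕ → Fin d) → map g vs ≡ x))

-- Cox(V): group generated by V with v² = 1.  Every element is a product
-- of generators (v⁻¹ = v), so elements are words List ℕ modulo the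
-- equivalence (indeed congruence) generated by  u v v w = u w.

data CoxStep : List ℕ → List ℕ → Set where
  cancel : (u w : List ℕ) (v : ℕ) → CoxStep (u ++ (v ∷ v ∷ w)) (u ++ w)

_≈Cox_ : List ℕ → List ℕ → Set
_≈Cox_ = EqClosure CoxStep

-- Cat_m: v_1 v_2⁻¹ v_3 ⋯ v_{m-1}⁻¹ v_m = v in Cox(V); since v⁻¹ = v in
-- Cox(V) this is the word v_1 v_2 ⋯ v_m.
Cat : (m : ℕ) → Pattern m
Cat m vs v = toList vs ≈Cox [ v ]

module Submission where

open import Defs
open import Data.Nat using (ℕ; zero; suc; _<?_)
open import Data.Fin using (Fin; zero; suc; inject₁; toℕ; fromℕ<)
open import Data.Fin.Properties using (fromℕ<-toℕ; toℕ<n) renaming (_≟_ to _≟ᶠ_)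
open import Data.Vec using (Vec; []; _∷_; lookup; toList)
import Data.Vec as Vec
open import Data.Vec.Properties using (toList-map)
open import Data.Vec.Membership.Propositional using (_∈_)
open import Data.Vec.Membership.Propositional.Properties using (∈-map⁺; ∈-toList⁻)
open import Data.List using (List; []; _∷_; _++_; [_]; foldr)
import Data.List as List
open import Data.List.Properties using (map-++)
import Data.List.Membership.Propositional as List
open import Data.List.Relation.Unary.Any using (here; there)
open import Data.Maybe using (Maybe; just; nothing)
open import Data.Product using (Σ; _×_; _,_; proj₂)
open import Data.Sum using (_⊎_; inj₁; inj₂)
open import Data.Unit using (⊤; tt)
open import Data.Empty using (⊥-elim)
open import Function.Base using (case_of_)
open import Function.Bundles using (_⇔_; mk⇔)
open import Relation.Nullary using (yes; no; ¬_)
open import Relation.Binary.Definitions using (DecidableEquality)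
open import Relation.Binary.PropositionalEquality hiding ([_])
open import Relation.Binary.Construct.Closure.Equivalence as EqClosure using (EqClosure)

-- A word over D equals a single letter a in the free Coxeter group
-- exactly when cancelling adjacent equal letters reduces it to a.  The Catalan
-- identities force ψ_k(x) = a for every such x of length 2k+1, while a member of
-- I_D(Cat_{2k+1}) is defined exactly on those x, with value a.  So every member
-- of I_D(Cat_m) is a restriction of ψ, and restrictions of partial polymorphisms
-- are partial polymorphisms.  Conversely, "the letter x reduces to" is itself a
-- Catalan family lying in every I_D(Cat_m).

data CancelStep {A : Set} : List A → List A → Set where
  cancel : (u w : List A) (v : A) → CancelStep (u ++ v ∷ v ∷ w) (u ++ w)

∷-CancelStep : ∀ {A : Set} (a : A) {l l′ : List A} →
  CancelStep l l′ → CancelStep (a ∷ l) (a ∷ l′)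
∷-CancelStep a (cancel u w v) = cancel (a ∷ u) w v

map-CoxStep : ∀ {A : Set} (g : ℕ → A) {l l′ : List ℕ} →
  CoxStep l l′ → CancelStep (List.map g l) (List.map g l′)
map-CoxStep g (cancel u w v) =
  subst₂ CancelStep (sym (map-++ g u (v ∷ v ∷ w))) (sym (map-++ g u w))
    (cancel (List.map g u) (List.map g w) (g v))

map-CancelStep : ∀ {A : Set} (g : A → ℕ) {l l′ : List A} →
  CancelStep l l′ → CoxStep (List.map g l) (List.map g l′)
map-CancelStep g (cancel u w v) =
  subst₂ CoxStep (sym (map-++ g u (v ∷ v ∷ w))) (sym (map-++ g u w))
    (cancel (List.map g u) (List.map g w) (g v))

removePair-CancelStep : ∀ {A : Set} {n} (x : Vec A (suc (suc n))) (i : Fin (suc n)) →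
  lookup x (inject₁ i) ≡ lookup x (suc i) →
  CancelStep (toList x) (toList (removePair x i))
removePair-CancelStep (a ∷ b ∷ xs) zero refl = cancel [] (toList xs) a
removePair-CancelStep {n = suc n} (a ∷ b ∷ xs) (suc i) eq =
  ∷-CancelStep a (removePair-CancelStep (b ∷ xs) i eq)

module FreeReduction {A : Set} (_≟_ : DecidableEquality A) where

  _≈_ : List A → List A → Set
  _≈_ = EqClosure CancelStep

  push : A → List A → List A
  push a [] = [ a ]
  push a (b ∷ s) with a ≟ b
  ... | yes _ = s
  ... | no _ = a ∷ b ∷ s

  reduce : List A → List A
  reduce = foldr push []

  Reduced : List A → Set
  Reduced [] = ⊤
  Reduced (a ∷ []) = ⊤
  Reduced (a ∷ b ∷ s) = ¬ a ≡ b × Reduced (b ∷ s)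

  Reduced-tail : ∀ {b s} → Reduced (b ∷ s) → Reduced s
  Reduced-tail {s = []} _ = tt
  Reduced-tail {s = _ ∷ _} (_ , r) = r

  push-Reduced : ∀ a s → Reduced s → Reduced (push a s)
  push-Reduced a [] _ = tt
  push-Reduced a (b ∷ s) r with a ≟ b
  ... | yes _ = Reduced-tail r
  ... | no a≢b = a≢b , r

  reduce-Reduced : ∀ l → Reduced (reduce l)
  reduce-Reduced [] = tt
  reduce-Reduced (a ∷ l) = push-Reduced a (reduce l) (reduce-Reduced l)

  reduce-Reduced-id : ∀ l → Reduced l → reduce l ≡ l
  reduce-Reduced-id [] _ = refl
  reduce-Reduced-id (a ∷ []) _ = refl
  reduce-Reduced-id (a ∷ b ∷ s) (a≢b , r) rewrite reduce-Reduced-id (b ∷ s) r with a ≟ b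
  ... | yes a≡b = ⊥-elim (a≢b a≡b)
  ... | no _ = refl

  push-involutive : ∀ v s → Reduced s → push v (push v s) ≡ s
  push-involutive v [] _ with v ≟ v
  ... | yes _ = refl
  ... | no v≢v = ⊥-elim (v≢v refl)
  push-involutive v (b ∷ s) r with v ≟ b
  push-involutive v (b ∷ []) r | yes refl = refl
  push-involutive v (b ∷ c ∷ s) (b≢c , _) | yes refl with v ≟ c
  ... | yes v≡c = ⊥-elim (b≢c v≡c)
  ... | no _ = refl
  push-involutive v (b ∷ s) r | no _ with v ≟ v
  ... | yes _ = refl
  ... | no v≢v = ⊥-elim (v≢v refl)

  reduce-++ : ∀ u w → reduce (u ++ w) ≡ foldr push (reduce w) u
  reduce-++ [] w = refl
  reduce-++ (a ∷ u) w = cong (push a) (reduce-++ u w)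

  reduce-CancelStep : ∀ {l l′} → CancelStep l l′ → reduce l ≡ reduce l′
  reduce-CancelStep (cancel u w v) = begin
    reduce (u ++ v ∷ v ∷ w)                   ≡⟨ reduce-++ u (v ∷ v ∷ w) ⟩
    foldr push (push v (push v (reduce w))) u ≡⟨ cong (λ s → foldr push s u)
                                                    (push-involutive v (reduce w) (reduce-Reduced w)) ⟩
    foldr push (reduce w) u                   ≡⟨ reduce-++ u w ⟨
    reduce (u ++ w)                           ∎
    where open ≡-Reasoning

  reduce-resp-≈ : ∀ {l l′} → l ≈ l′ → reduce l ≡ reduce l′
  reduce-resp-≈ = EqClosure.gfold isEquivalence reduce reduce-CancelStep

  push-≈ : ∀ a s → (a ∷ s) ≈ push a s
  push-≈ a [] = EqClosure.reflexive CancelStep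
  push-≈ a (b ∷ s) with a ≟ b
  ... | yes refl = EqClosure.return (cancel [] s a)
  ... | no _ = EqClosure.reflexive CancelStep

  ≈-reduce : ∀ l → l ≈ reduce l
  ≈-reduce [] = EqClosure.reflexive CancelStep
  ≈-reduce (a ∷ l) = EqClosure.transitive CancelStep
    (EqClosure.gmap (a ∷_) (∷-CancelStep a) (≈-reduce l)) (push-≈ a (reduce l))

  push-⊆ : ∀ {b} a s → b List.∈ push a s → b List.∈ a ∷ s
  push-⊆ a [] b∈ = b∈
  push-⊆ a (c ∷ s) b∈ with a ≟ c
  ... | yes _ = there (there b∈)
  ... | no _ = b∈

  reduce-⊆ : ∀ {b} l → b List.∈ reduce l → b List.∈ l
  reduce-⊆ (a ∷ l) b∈ with push-⊆ a (reduce l) b∈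
  ... | here b≡a = here b≡a
  ... | there b∈′ = there (reduce-⊆ l b∈′)

  Reduced⊎adjacent : ∀ {n} (x : Vec A (suc n)) →
    Reduced (toList x) ⊎ Σ (Fin n) λ i → lookup x (inject₁ i) ≡ lookup x (suc i)
  Reduced⊎adjacent (a ∷ []) = inj₁ tt
  Reduced⊎adjacent (a ∷ b ∷ xs) with a ≟ b
  ... | yes a≡b = inj₂ (zero , a≡b)
  ... | no a≢b with Reduced⊎adjacent (b ∷ xs)
  ... | inj₁ r = inj₁ (a≢b , r)
  ... | inj₂ (i , eq) = inj₂ (suc i , eq)

_⊑_ : ∀ {X B : Set} → (X → Maybe B) → (X → Maybe B) → Set
f ⊑ h = ∀ x a → f x ≡ just a → h x ≡ just a

⊑-IsPartialPolymorphism : ∀ {d r m} (P : Vec (Fin d) r → Set) {f h : PartialFun d m} →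
  f ⊑ h → IsPartialPolymorphism P h → IsPartialPolymorphism P f
⊑-IsPartialPolymorphism P f⊑h h-pol ts ts∈P y f-cols = h-pol ts ts∈P y (λ j → f⊑h _ _ (f-cols j))

module _ {d : ℕ} where
  open FreeReduction (_≟ᶠ_ {d})

  single : List (Fin d) → Maybe (Fin d)
  single (a ∷ []) = just a
  single _ = nothing

  reducedLetter : ∀ {m} → PartialFun d m
  reducedLetter x = single (reduce (toList x))

  Cat⇒reduce : ∀ {m} {vs : Vec ℕ m} {v} (g : ℕ → Fin d) → Cat m vs v →
    reduce (toList (Vec.map g vs)) ≡ [ g v ]
  Cat⇒reduce {vs = vs} g cat = trans (cong reduce (toList-map g vs))
    (reduce-resp-≈ (EqClosure.gmap (List.map g) (map-CoxStep g) cat))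

  reduce⇒Cat : ∀ {m} (x : Vec (Fin d) m) {a} → reduce (toList x) ≡ [ a ] →
    Cat m (Vec.map toℕ x) (toℕ a)
  reduce⇒Cat x eq = subst (λ l → l ≈Cox [ _ ]) (sym (toList-map toℕ x))
    (EqClosure.gmap (List.map toℕ) (map-CancelStep toℕ)
      (subst (toList x ≈_) eq (≈-reduce (toList x))))

  -- A left inverse of toℕ; the letter a is only a default for numbers ≥ d.
  retract : Fin d → ℕ → Fin d
  retract a n with n <? d
  ... | yes n<d = fromℕ< n<d
  ... | no _ = a

  retract-toℕ : ∀ a i → retract a (toℕ i) ≡ i
  retract-toℕ a i with toℕ i <? d
  ... | yes i<d = fromℕ<-toℕ i i<d
  ... | no i≮d = ⊥-elim (i≮d (toℕ<n i))

  map-retract-toℕ : ∀ a {m} (x : Vec (Fin d) m) → Vec.map (retract a) (Vec.map toℕ x) ≡ x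
  map-retract-toℕ a [] = refl
  map-retract-toℕ a (b ∷ x) = cong₂ _∷_ (retract-toℕ a b) (map-retract-toℕ a x)

  reducedLetter-InI : ∀ m → InI (Cat m) (reducedLetter {m})
  reducedLetter-InI m = defined , domain
    where
    defined : ∀ vs v → Cat m vs v → ∀ g →
      Σ (Fin d) (λ a → reducedLetter (Vec.map g vs) ≡ just a) ×
      (v ∈ vs → reducedLetter (Vec.map g vs) ≡ just (g v))
    defined vs v cat g rewrite Cat⇒reduce g cat = (g v , refl) , λ _ → refl

    domain : ∀ x → reducedLetter x ≢ nothing →
      Σ (Vec ℕ m) λ vs → Σ ℕ λ v → Cat m vs v × Σ (ℕ → Fin d) λ g → Vec.map g vs ≡ x
    domain x defined with reduce (toList x) in eq
    ... | [] = ⊥-elim (defined refl)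
    ... | _ ∷ _ ∷ _ = ⊥-elim (defined refl)
    ... | a ∷ [] = Vec.map toℕ x , toℕ a , reduce⇒Cat x eq , retract a , map-retract-toℕ a x

  reducedLetter-Catalan : CatalanIdentities (λ k → reducedLetter {odd k})
  reducedLetter-Catalan =
    (λ { (a ∷ []) → refl }) ,
    (λ k x i eq → cong single (reduce-CancelStep (removePair-CancelStep x i eq)))

  InI-Cat-value : ∀ {m} {f : PartialFun d m} → InI (Cat m) f →
    ∀ x {a} → reduce (toList x) ≡ [ a ] → f x ≡ just a
  InI-Cat-value {f = f} (defined , _) x {a} eq = begin
    f x                                     ≡⟨ cong f (map-retract-toℕ a x) ⟨
    f (Vec.map (retract a) (Vec.map toℕ x)) ≡⟨ proj₂ (defined _ _ (reduce⇒Cat x eq) (retract a)) toℕa∈ ⟩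
    just (retract a (toℕ a))                ≡⟨ cong just (retract-toℕ a a) ⟩
    just a                                  ∎
    where
    open ≡-Reasoning
    toℕa∈ : toℕ a ∈ Vec.map toℕ x
    toℕa∈ = ∈-map⁺ toℕ (∈-toList⁻ (reduce-⊆ (toList x) (subst (a List.∈_) (sym eq) (here refl))))

  InI-Cat-domain : ∀ {m} {f : PartialFun d m} → InI (Cat m) f →
    ∀ x {a} → f x ≡ just a → reduce (toList x) ≡ [ a ]
  InI-Cat-domain inI@(_ , domain) x fx≡a
    with domain x (λ fx≡nothing → case trans (sym fx≡a) fx≡nothing of λ ())
  ... | vs , v , cat , g , refl with Cat⇒reduce g cat
  ... | eq with trans (sym fx≡a) (InI-Cat-value inI _ eq)
  ... | refl = eq

  Catalan-reduce : ∀ (φ : (k : ℕ) → PartialFun d (odd k)) → CatalanIdentities φ →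
    ∀ k x {a} → reduce (toList x) ≡ [ a ] → φ k x ≡ just a
  Catalan-reduce φ (base , _) zero (b ∷ []) refl = base (b ∷ [])
  Catalan-reduce φ cat (suc k) x@(_ ∷ _ ∷ _) eq with Reduced⊎adjacent x
  -- a reduced word is its own reduction, and this one has length ≥ 3
  ... | inj₁ r with trans (sym (reduce-Reduced-id (toList x) r)) eq
  ...   | ()
  Catalan-reduce φ cat (suc k) x eq | inj₂ (i , xᵢ≡xᵢ₊₁) =
    trans (proj₂ cat k x i xᵢ≡xᵢ₊₁)
      (Catalan-reduce φ cat k (removePair x i)
        (trans (sym (reduce-CancelStep (removePair-CancelStep x i xᵢ≡xᵢ₊₁))) eq))

  InI-Cat-⊑-Catalan : ∀ (φ : (k : ℕ) → PartialFun d (odd k)) → CatalanIdentities φ →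
    ∀ k {f : PartialFun d (odd k)} → InI (Cat (odd k)) f → f ⊑ φ k
  InI-Cat-⊑-Catalan φ cat k inI x a fx≡a = Catalan-reduce φ cat k x (InI-Cat-domain inI x fx≡a)

proposition7p11 : (d r : ℕ) (P : Vec (Fin d) r → Set) →
    (Σ ((k : ℕ) → PartialFun d (odd k)) λ ψ →
       ((k : ℕ) → IsPartialPolymorphism P (ψ k)) × CatalanIdentities ψ)
    ⇔
    ((k : ℕ) (f : PartialFun d (odd k)) →
       InI (Cat (odd k)) f → IsPartialPolymorphism P f)
proposition7p11 d r P = mk⇔
  (λ { (ψ , ψ-pol , ψ-cat) k f inI →
         ⊑-IsPartialPolymorphism P (InI-Cat-⊑-Catalan ψ ψ-cat k inI) (ψ-pol k) })
  (λ I-pol → (λ k → reducedLetter) ,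
             (λ k → I-pol k reducedLetter (reducedLetter-InI (odd k))) ,
             reducedLetter-Catalan)
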